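{- Let $L$ be a lax extension of the functor $H_A=(-)^A\colon\mathbf{Set}\to\mathbf{Set}$. Then the set $S(L)=\{\phi\subseteq A\times A\mid 1_A\,(L\phi)\,1_A\}$ is an upwards-closed submonoid of the monoid of endorelations on $A$. Furthermore, $S(L)$ is closed under converses if $L$ preserves converses, and every relation in $S(L)$ is normal if $L$ is normal.
   Context: Relations are composed applicatively, $^\circ$ is converse, functions are regarded as relations, $1_A$ is the identity (also viewed as an element of $A^A$). A lax extension of $H_A$ is a monotone assignment of $Lr\subseteq X^A\times Y^A$ to each relation $r\subseteq X\times Y$ with $H_Af\le Lf$, $(H_Af)^\circ\le L(f^\circ)$ and $Ls\cdot Lr\le L(s\cdot r)$; it is normal if $L1_X=1_{X^A}$ and preserves converses if $L(r^\circ)=(Lr)^\circ$. The monoid of endorelations on $A$ is under relational composition with unit $1_A$, ordered by inclusion. An endorelation is normal if its difunctional closure (least relation of the form $g^\circ\cdot f$ containing it) is reflexive. -}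

module Defs where

open import Data.Product using (Σ; ∃; _×_; _,_)
open import Relation.Binary.PropositionalEquality using (_≡_)
open import Function using (_∘_)

Rel : Set → Set → Set₁
Rel X Y = X → Y → Set

_⊑_ : {X Y : Set} → Rel X Y → Rel X Y → Set
r ⊑ s = ∀ x y → r x y → s x y
infix 4 _⊑_

_·_ : {X Y Z : Set} → Rel Y Z → Rel X Y → Rel X Z
(s · r) x z = ∃ λ y → r x y × s y z
infixr 9 _·_

_° : {X Y : Set} → Rel X Y → Rel Y X
(r °) y x = r x y
infix 10 _°

⟦_⟧ : {X Y : Set} → (X → Y) → Rel X Y
⟦ f ⟧ x y = f x ≡ y

1R : (X : Set) → Rel X X
1R X = _≡_

H : (A : Set) {X Y : Set} → (X → Y) → (A → X) → (A → Y)
H A f u = f ∘ u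

record LaxExtension (A : Set) : Set₁ where
  field
    L        : {X Y : Set} → Rel X Y → Rel (A → X) (A → Y)
    mono     : {X Y : Set} {r s : Rel X Y} → r ⊑ s → L r ⊑ L s
    fun      : {X Y : Set} (f : X → Y) → ⟦ H A f ⟧ ⊑ L ⟦ f ⟧
    fun°     : {X Y : Set} (f : X → Y) → ⟦ H A f ⟧ ° ⊑ L (⟦ f ⟧ °)
    comp     : {X Y Z : Set} (r : Rel X Y) (s : Rel Y Z) → L s · L r ⊑ L (s · r)

module _ {A : Set} (E : LaxExtension A) where
  open LaxExtension E

  IsNormalLax : Set₁
  IsNormalLax = ∀ (X : Set) → (L (1R X) ⊑ 1R (A → X)) × (1R (A → X) ⊑ L (1R X))

  PreservesConverse : Set₁
  PreservesConverse = ∀ {X Y : Set} (r : Rel X Y) → (L (r °) ⊑ (L r) °) × ((L r) ° ⊑ L (r °))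

  S : Rel A A → Set
  S φ = L φ (λ a → a) (λ a → a)

Reflexive : {A : Set} → Rel A A → Set
Reflexive {A} r = ∀ (a : A) → r a a

-- An endorelation φ is normal iff its difunctional closure (the least relation
-- of the form g° · f containing φ) is reflexive; equivalently every relation
-- of the form g° · f containing φ is reflexive.
NormalRel : {A : Set} → Rel A A → Set₁
NormalRel {A} φ = ∀ (Z : Set) (f g : A → Z) → φ ⊑ (⟦ g ⟧ ° · ⟦ f ⟧) → Reflexive (⟦ g ⟧ ° · ⟦ f ⟧)

{-# OPTIONS --safe #-}
-- The closure properties of S(L) are the lax-extension axioms instantiated at
-- the identity 1_A ∈ A^A. For normality, conjugating 1_A (L φ) 1_A by maps
-- f, g : A → Z yields f (L (g · φ · f°)) g; if φ ⊆ g° · f then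
-- g · φ · f° ⊆ 1_Z, so normality of L forces f = g, and g° · f = f° · f is
-- reflexive.
module Submission where

open import Defs
open import Data.Product using (_×_; _,_; proj₁; proj₂)
open import Function using (id; _∘_)
open import Relation.Binary.PropositionalEquality using (_≡_; refl; sym; trans)

graph-conjugate-⊑-1 : {X Y Z : Set} {f : X → Z} {g : Y → Z} {r : Rel X Y} →
                      r ⊑ ⟦ g ⟧ ° · ⟦ f ⟧ → ⟦ g ⟧ · r · ⟦ f ⟧ ° ⊑ 1R Z
graph-conjugate-⊑-1 r⊑g°f z w (y , (x , fx≡z , rxy) , gy≡w)
  with r⊑g°f x y rxy
... | (u , fx≡u , gy≡u) = trans (sym fx≡z) (trans fx≡u (trans (sym gy≡u) gy≡w))

difunctional-reflexive : {X Z : Set} {f g : X → Z} → f ≡ g → Reflexive (⟦ g ⟧ ° · ⟦ f ⟧)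
difunctional-reflexive {f = f} refl x = f x , refl , refl

module _ {A : Set} (E : LaxExtension A) where
  open LaxExtension E

  L-conjugate : {X Y Z W : Set} {r : Rel X Y} (f : X → Z) (g : Y → W) {u : A → X} {v : A → Y} →
                L r u v → L (⟦ g ⟧ · r · ⟦ f ⟧ °) (f ∘ u) (g ∘ v)
  L-conjugate {r = r} f g {u} {v} urv =
    comp (r · ⟦ f ⟧ °) ⟦ g ⟧ _ _ (v , f∘u[r·f°]v , fun g v (g ∘ v) refl)
    where
    f∘u[r·f°]v : L (r · ⟦ f ⟧ °) (f ∘ u) v
    f∘u[r·f°]v = comp (⟦ f ⟧ °) r _ _ (u , fun° f (f ∘ u) u refl , urv)

  S-1 : S E (1R A)
  S-1 = fun id id id refl

  S-· : (φ ψ : Rel A A) → S E φ → S E ψ → S E (ψ · φ)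
  S-· φ ψ sφ sψ = comp φ ψ id id (id , sφ , sψ)

  S-mono : (φ ψ : Rel A A) → φ ⊑ ψ → S E φ → S E ψ
  S-mono φ ψ φ⊑ψ = mono φ⊑ψ id id

  S-° : PreservesConverse E → (φ : Rel A A) → S E φ → S E (φ °)
  S-° preserves φ = proj₂ (preserves φ) id id

  S-graph-bound⇒≡ : IsNormalLax E → {Z : Set} {f g : A → Z} {φ : Rel A A} →
                    S E φ → φ ⊑ ⟦ g ⟧ ° · ⟦ f ⟧ → f ≡ g
  S-graph-bound⇒≡ normal {Z} {f} {g} sφ φ⊑g°f =
    proj₁ (normal Z) f g (mono (graph-conjugate-⊑-1 φ⊑g°f) f g (L-conjugate f g sφ))

  S-normal : IsNormalLax E → (φ : Rel A A) → S E φ → NormalRel φ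
  S-normal normal φ sφ Z f g φ⊑g°f = difunctional-reflexive (S-graph-bound⇒≡ normal sφ φ⊑g°f)

proposition33 : (A : Set) (E : LaxExtension A)
    → (S E (1R A)
       × (∀ (φ ψ : Rel A A) → S E φ → S E ψ → S E (ψ · φ))
       × (∀ (φ ψ : Rel A A) → φ ⊑ ψ → S E φ → S E ψ))
      × (PreservesConverse E → ∀ (φ : Rel A A) → S E φ → S E (φ °))
      × (IsNormalLax E → ∀ (φ : Rel A A) → S E φ → NormalRel φ)
proposition33 A E = (S-1 E , S-· E , S-mono E) , S-° E , S-normal E
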